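{- Let $G=(V,E)$ be a directed graph with $V=\{v_1,\dots,v_n\}$, without self-loops and in which every vertex has at least one outgoing edge. Construct the game graph $\Gamma$ whose vertex set consists of a start vertex $s$ and four copies $V^1,V^2,V^3,V^4$ of $V$, with $v_{ji}\in V^j$ the copy of $v_i$; edges: $(s,v_{1i})$ for all $i$, and for $1\le j\le 3$, $(v_{ji},v_{(j+1)l})$ iff $(v_i,v_l)\in E$; all vertices are player-2 vertices (there are no player-1 vertices). Let the target sets be $T_i=(V^1\setminus\{v_{1i}\})\cup(V^4\setminus\{v_{4i}\})$ for $i=1,\dots,n$. Then $G$ contains a triangle (vertices $x,y,z$ with $(x,y),(y,z),(z,x)\in E$) if and only if player 1 has no winning policy from $s$ for the coverage objective with targets $T_1,\dots,T_n$.
   Context: In a game graph, vertices are partitioned into player-1 and player-2 vertices; player $i$ chooses successors at its vertices according to a policy. A player-1 policy is winning from $s$ for objective $\phi$ if for every player-2 policy the resulting play lies in $\phi$. $\mathrm{Reach}(T)$ is the set of plays visiting $T$. Player 1 has a winning policy from $s$ for the coverage objective with targets $T_1,\dots,T_n$ if for every $i$ there is a player-1 policy (possibly depending on $i$) winning from $s$ for $\mathrm{Reach}(T_i)$. -}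

module Defs where

open import Data.Bool using (Bool; true; false)
open import Data.Nat using (ℕ)
open import Data.Fin using (Fin)
open import Data.List using (List; []; _∷_)
open import Data.Maybe using (Maybe; just; nothing)
open import Data.Product using (Σ; _×_; _,_; proj₁; ∃; ∃-syntax)
open import Data.Sum using (_⊎_)
open import Data.Empty using (⊥)
open import Relation.Nullary using (¬_)
open import Relation.Binary.PropositionalEquality using (_≡_; _≢_; refl)

-- owner v ≡ true  : v is a player-1 vertex
-- owner v ≡ false : v is a player-2 vertex
record GameGraph : Set₁ where
  field
    Vtx   : Set
    Edge  : Vtx → Vtx → Set
    owner : Vtx → Bool

module _ (Γ : GameGraph) where
  open GameGraph Γ

  -- A (history-dependent, deterministic) policy of player b: given the
  -- history so far (most recent first, excluding the current vertex) and the
  -- current vertex v owned by b, it chooses a successor of v; it may answer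
  -- 'nothing' only when v has no successor at all (the play then ends).
  Policy : Bool → Set
  Policy b =
    Σ (List Vtx → (v : Vtx) → owner v ≡ b → Maybe (Σ Vtx (Edge v))) λ f →
      ∀ h v (o : owner v ≡ b) → f h v o ≡ nothing → ¬ Σ Vtx (Edge v)

  nextMove : Policy true → Policy false → List Vtx → (v : Vtx) →
             Maybe (Σ Vtx (Edge v))
  nextMove σ₁ σ₂ h v = pick (owner v) refl
    where
    pick : (b : Bool) → owner v ≡ b → Maybe (Σ Vtx (Edge v))
    pick true  o = proj₁ σ₁ h v o
    pick false o = proj₁ σ₂ h v o

  data Visits (σ₁ : Policy true) (σ₂ : Policy false) (T : Vtx → Set)
       : List Vtx → Vtx → Set where
    here : ∀ {h v} → T v → Visits σ₁ σ₂ T h v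
    step : ∀ {h v w} {e : Edge v w} →
           nextMove σ₁ σ₂ h v ≡ just (w , e) →
           Visits σ₁ σ₂ T (v ∷ h) w → Visits σ₁ σ₂ T h v

  WinningReach : Policy true → Vtx → (Vtx → Set) → Set
  WinningReach σ₁ s T = (σ₂ : Policy false) → Visits σ₁ σ₂ T [] s

  CoverageWin : Vtx → {n : ℕ} → (Fin n → (Vtx → Set)) → Set
  CoverageWin s {n} T = (i : Fin n) → Σ (Policy true) λ σ₁ → WinningReach σ₁ s (T i)

Digraph : ℕ → Set
Digraph n = Fin n → Fin n → Bool

EdgeG : ∀ {n} → Digraph n → Fin n → Fin n → Set
EdgeG G x y = G x y ≡ true

NoSelfLoops : ∀ {n} → Digraph n → Set
NoSelfLoops G = ∀ x → ¬ EdgeG G x x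

AllHaveOutEdge : ∀ {n} → Digraph n → Set
AllHaveOutEdge G = ∀ x → ∃[ y ] EdgeG G x y

HasTriangle : ∀ {n} → Digraph n → Set
HasTriangle {n} G = Σ (Fin n) λ x → Σ (Fin n) λ y → Σ (Fin n) λ z →
  EdgeG G x y × EdgeG G y z × EdgeG G z x

data Layer : Set where
  L1 L2 L3 L4 : Layer

data RVtx (n : ℕ) : Set where
  s : RVtx n
  v : Layer → Fin n → RVtx n

data REdge {n : ℕ} (G : Digraph n) : RVtx n → RVtx n → Set where
  start : ∀ i → REdge G s (v L1 i)
  e12 : ∀ {i l} → EdgeG G i l → REdge G (v L1 i) (v L2 l)
  e23 : ∀ {i l} → EdgeG G i l → REdge G (v L2 i) (v L3 l)
  e34 : ∀ {i l} → EdgeG G i l → REdge G (v L3 i) (v L4 l)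

ReductionGame : ∀ {n} → Digraph n → GameGraph
ReductionGame {n} G = record
  { Vtx = RVtx n ; Edge = REdge G ; owner = λ _ → false }

Target : ∀ {n} → Fin n → RVtx n → Set
Target i s = ⊥
Target i (v L1 l) = l ≢ i
Target i (v L2 l) = ⊥
Target i (v L3 l) = ⊥
Target i (v L4 l) = l ≢ i

-- Player 1 owns no vertex, so it wins Reach(T_i) iff every play from s
-- visits T_i. A play runs s, v_{1a}, v_{2b}, v_{3c}, v_{4d} along a walk
-- a → b → c → d of G, and it avoids T_i exactly when a = d = i, i.e. when
-- the walk closes up into a triangle through v_i. Conversely, player 2 can
-- steer the play around any triangle x → y → z → x and so defeat T_x.
module Submission where

open import Defs
open import Data.Nat using (ℕ)
open import Function.Bundles using (_⇔_; mk⇔)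
open import Data.Bool using (true; false)
import Data.Bool.Properties as Bool
open import Data.Fin using (Fin; _≟_)
open import Data.Fin.Properties using (any?)
open import Data.List using (List; []; _∷_)
open import Data.List.Relation.Unary.Any using (Any; here; there)
open import Data.Maybe using (just; nothing)
open import Data.Product using (Σ; ∃₂; _,_; proj₁; proj₂)
open import Relation.Nullary using (¬_; Dec; yes; no; contradiction)
open import Relation.Nullary.Decidable using (_×-dec_; decidable-stable)
open import Relation.Binary.PropositionalEquality using (_≡_; refl; subst)

hasTriangle? : ∀ {n} (G : Digraph n) → Dec (HasTriangle G)
hasTriangle? G = any? λ x → any? λ y → any? λ z →
  (G x y Bool.≟ true) ×-dec (G y z Bool.≟ true) ×-dec (G z x Bool.≟ true)

closedPlay-avoids : ∀ {n} {x y z : Fin n} →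
  ¬ Any (Target x) (s ∷ v L1 x ∷ v L2 y ∷ v L3 z ∷ v L4 x ∷ [])
closedPlay-avoids (there (here x≢x)) = x≢x refl
closedPlay-avoids (there (there (there (there (here x≢x))))) = x≢x refl
closedPlay-avoids (here ())
closedPlay-avoids (there (there (here ())))
closedPlay-avoids (there (there (there (here ()))))
closedPlay-avoids (there (there (there (there (there ())))))

module _ {n : ℕ} (G : Digraph n) where

  private
    Γ : GameGraph
    Γ = ReductionGame G

  idlePolicy : Policy Γ true
  idlePolicy = (λ _ _ ()) , (λ _ _ ())

  forcedMove : ∀ σ₁ (σ₂ : Policy Γ false) h {u} → Σ (RVtx n) (REdge G u) →
               ∃₂ λ w (e : REdge G u w) → nextMove Γ σ₁ σ₂ h u ≡ just (w , e)
  forcedMove σ₁ σ₂ h {u} move with proj₁ σ₂ h u refl in chosen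
  ... | just (w , e) = w , e , refl
  ... | nothing      = contradiction move (proj₂ σ₂ h u refl chosen)

  triangleFree⇒coverageWin : AllHaveOutEdge G → ¬ HasTriangle G →
                             CoverageWin Γ s Target
  triangleFree⇒coverageWin out triangleFree i = idlePolicy , visits-s
    where
    module _ (σ₂ : Policy Γ false) where
      Visitsᵢ : List (RVtx n) → RVtx n → Set
      Visitsᵢ = Visits Γ idlePolicy σ₂ (Target i)

      visits-L3 : ∀ h {b c} → EdgeG G i b → EdgeG G b c → Visitsᵢ h (v L3 c)
      visits-L3 h {b} {c} ib bc with forcedMove idlePolicy σ₂ h (v L4 _ , e34 (proj₂ (out c)))
      ... | v L4 d , e34 cd , moved with d ≟ i
      ...   | yes refl = contradiction (i , b , c , ib , bc , cd) triangleFree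
      ...   | no d≢i   = step moved (here d≢i)

      visits-L2 : ∀ h {b} → EdgeG G i b → Visitsᵢ h (v L2 b)
      visits-L2 h {b} ib with forcedMove idlePolicy σ₂ h (v L3 _ , e23 (proj₂ (out b)))
      ... | v L3 c , e23 bc , moved = step moved (visits-L3 _ ib bc)

      visits-L1 : ∀ h a → Visitsᵢ h (v L1 a)
      visits-L1 h a with a ≟ i
      ... | no a≢i = here a≢i
      ... | yes refl with forcedMove idlePolicy σ₂ h (v L2 _ , e12 (proj₂ (out a)))
      ...   | v L2 b , e12 ab , moved = step moved (visits-L2 _ ab)

      visits-s : Visitsᵢ [] s
      visits-s with forcedMove idlePolicy σ₂ [] (v L1 i , start i)
      ... | v L1 a , start .a , moved = step moved (visits-L1 _ a)

  -- Successor functions of G serve as player 2's choices: cₖ leads from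
  -- layer k to layer k+1.
  layeredPolicy : Fin n → (c₁ c₂ c₃ : AllHaveOutEdge G) → Policy Γ false
  layeredPolicy a c₁ c₂ c₃ = move , move-total
    where
    move : List (RVtx n) → (u : RVtx n) → false ≡ false → _
    move _ s        _ = just (v L1 a , start a)
    move _ (v L1 b) _ = just (v L2 _ , e12 (proj₂ (c₁ b)))
    move _ (v L2 b) _ = just (v L3 _ , e23 (proj₂ (c₂ b)))
    move _ (v L3 b) _ = just (v L4 _ , e34 (proj₂ (c₃ b)))
    move _ (v L4 _) _ = nothing

    move-total : ∀ h u o → move h u o ≡ nothing → ¬ Σ (RVtx n) (REdge G u)
    move-total _ s        _ ()
    move-total _ (v L1 _) _ ()
    move-total _ (v L2 _) _ ()
    move-total _ (v L3 _) _ ()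
    move-total _ (v L4 _) _ _ (_ , ())

  layeredPlay : Fin n → (c₁ c₂ c₃ : AllHaveOutEdge G) → List (RVtx n)
  layeredPlay a c₁ c₂ c₃ = s ∷ v L1 a ∷ v L2 b ∷ v L3 c ∷ v L4 d ∷ []
    where
    b = proj₁ (c₁ a)
    c = proj₁ (c₂ b)
    d = proj₁ (c₃ c)

  visits⇒any-layeredPlay : ∀ {σ₁ T} a c₁ c₂ c₃ →
    Visits Γ σ₁ (layeredPolicy a c₁ c₂ c₃) T [] s → Any T (layeredPlay a c₁ c₂ c₃)
  visits⇒any-layeredPlay _ _ _ _ (here t) = here t
  visits⇒any-layeredPlay _ _ _ _ (step refl (here t)) = there (here t)
  visits⇒any-layeredPlay _ _ _ _ (step refl (step refl (here t))) =
    there (there (here t))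
  visits⇒any-layeredPlay _ _ _ _ (step refl (step refl (step refl (here t)))) =
    there (there (there (here t)))
  visits⇒any-layeredPlay _ _ _ _ (step refl (step refl (step refl (step refl (here t))))) =
    there (there (there (there (here t))))
  visits⇒any-layeredPlay _ _ _ _ (step refl (step refl (step refl (step refl (step () _)))))

  redirect : AllHaveOutEdge G → ∀ {a b} → EdgeG G a b → AllHaveOutEdge G
  redirect out {a} {b} ab c with c ≟ a
  ... | yes refl = b , ab
  ... | no _     = out c

  redirect-at : ∀ out {a b} (ab : EdgeG G a b) → proj₁ (redirect out ab a) ≡ b
  redirect-at out {a} ab with a ≟ a
  ... | yes refl = refl
  ... | no a≢a   = contradiction refl a≢a

  layeredPlay-triangle : ∀ out {x y z} (xy : EdgeG G x y) (yz : EdgeG G y z) (zx : EdgeG G z x) →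
    layeredPlay x (redirect out xy) (redirect out yz) (redirect out zx)
      ≡ s ∷ v L1 x ∷ v L2 y ∷ v L3 z ∷ v L4 x ∷ []
  layeredPlay-triangle out xy yz zx
    rewrite redirect-at out xy | redirect-at out yz | redirect-at out zx = refl

  triangle⇒¬coverageWin : AllHaveOutEdge G → HasTriangle G → ¬ CoverageWin Γ s Target
  triangle⇒¬coverageWin out (x , y , z , xy , yz , zx) win =
    closedPlay-avoids (subst (Any (Target x)) (layeredPlay-triangle out xy yz zx)
      (visits⇒any-layeredPlay x _ _ _ (proj₂ (win x) triangleCycler)))
    where
    triangleCycler : Policy Γ false
    triangleCycler = layeredPolicy x (redirect out xy) (redirect out yz) (redirect out zx)

-- Self-loops are harmless: a loop at x is a triangle x = y = z, and the
-- play s, v₁ₓ, v₂ₓ, v₃ₓ, v₄ₓ avoids T_x.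
mainTheorem12 : (n : ℕ) (G : Digraph n) → NoSelfLoops G → AllHaveOutEdge G →
    HasTriangle G ⇔ (¬ CoverageWin (ReductionGame G) s Target)
mainTheorem12 n G _ out = mk⇔ (triangle⇒¬coverageWin G out) λ lose →
  decidable-stable (hasTriangle? G) λ triangleFree →
    lose (triangleFree⇒coverageWin G out triangleFree)
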